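{- Let $G$ be a finite connected undirected unweighted graph whose edge set is covered by shortest paths $\mu_1,\dots,\mu_k$, each endowed with a direction. Let $a,b,c$ be vertices of $G$ with $\operatorname{dist}(a,b)=\operatorname{dist}(a,c)$. Let $(P,\operatorname{col})$ be a well-coloured $a$-$b$ path with $P$ a shortest $a$-$b$ path, and $(P',\operatorname{col}')$ a well-coloured $a$-$c$ path with $P'$ a shortest $a$-$c$ path. If $\operatorname{ColoursSignsW}(P,\operatorname{col})=\operatorname{ColoursSignsW}(P',\operatorname{col}')$, then $b=c$.
   Context: Paths are simple and are viewed as directed from their first to last vertex. For an edge $e$, $\operatorname{colours}(e)=\{c: e\in E(\mu_c)\}$. A colouring of a path $P$ is a map $\operatorname{col}:E(P)\to\{1,\dots,k\}$ with $\operatorname{col}(e)\in\operatorname{colours}(e)$; it is good if for every colour $c$ the edges coloured $c$ form a connected subpath of $P$; $(P,\operatorname{col})$ with good $\operatorname{col}$ is well-coloured. A well-coloured path decomposes into maximal monochromatic subpaths with colours $c_1,\dots,c_l$ in order along the path; each such subpath of colour $c_i$ (a subpath of $\mu_{c_i}$) has sign $s_i=+$ if it traverses $\mu_{c_i}$ in $\mu_{c_i}$'s direction and $s_i=-$ otherwise. The colours-signs word is $\operatorname{ColoursSignsW}(P,\operatorname{col})=((c_1,s_1),\dots,(c_l,s_l))$. -}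

module Defs where

open import Data.Nat using (ℕ; _≤_; _∸_)
open import Data.Fin using (Fin; _≟_)
import Data.Fin as F
open import Data.List using (List; []; _∷_; length; map; reverse; lookup)
open import Data.List.Relation.Unary.All using (All)
open import Data.List.Relation.Unary.Unique.Propositional using (Unique)
open import Data.List.Relation.Binary.Pointwise using (Pointwise)
open import Data.List.Relation.Binary.Infix.Heterogeneous using (Infix)
open import Data.List.Membership.Propositional using (_∈_)
open import Data.Product using (Σ; ∃; _×_; _,_; swap)
open import Data.Sum using (_⊎_)
open import Relation.Nullary using (¬_; yes; no)
open import Relation.Binary.PropositionalEquality using (_≡_)

record Graph (n : ℕ) : Set₁ where
  field
    Adj     : Fin n → Fin n → Set
    symm    : ∀ {u v} → Adj u v → Adj v u
    irrefl  : ∀ {u} → ¬ Adj u u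

module _ {n : ℕ} where

  V : Set
  V = Fin n

  lastV : V → List V → V
  lastV u []       = u
  lastV u (y ∷ ys) = lastV y ys

  edges : List V → List (V × V)
  edges []           = []
  edges (x ∷ [])     = []
  edges (x ∷ y ∷ xs) = (x , y) ∷ edges (y ∷ xs)

  len : List V → ℕ
  len xs = length (edges xs)

  Walk : Graph n → V → V → List V → Set
  Walk G u v xs =
    Σ (List V) λ ys → (xs ≡ u ∷ ys) × (lastV u ys ≡ v)
      × All (λ e → Graph.Adj G (Data.Product.proj₁ e) (Data.Product.proj₂ e)) (edges xs)

  PathFT : Graph n → V → V → List V → Set
  PathFT G u v xs = Walk G u v xs × Unique xs

  ShortestPath : Graph n → V → V → List V → Set
  ShortestPath G u v xs =
    PathFT G u v xs × (∀ ys → Walk G u v ys → len xs ≤ len ys)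

  IsDist : Graph n → V → V → ℕ → Set
  IsDist G u v d =
    (Σ (List V) λ xs → Walk G u v xs × len xs ≡ d)
      × (∀ ys → Walk G u v ys → d ≤ len ys)

  Connected : Graph n → Set
  Connected G = ∀ u v → Σ (List V) λ xs → Walk G u v xs

  EdgeIn : V × V → List V → Set
  EdgeIn (u , v) μ = ((u , v) ∈ edges μ) ⊎ ((v , u) ∈ edges μ)

  module _ {k : ℕ} (μ : Fin k → List V) where

    -- a colouring of P: one colour per edge (in order), col(e) ∈ colours(e)
    Colouring : List V → List (Fin k) → Set
    Colouring P col = Pointwise (λ e c → EdgeIn e (μ c)) (edges P) col

    -- good: for every colour, the edges of that colour form a contiguous
    -- (hence connected) subpath of P
    Good : List (Fin k) → Set
    Good col = ∀ (i j l : Fin (length col)) → i F.≤ j → j F.≤ l →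
      lookup col i ≡ lookup col l → lookup col j ≡ lookup col i

    WellColoured : List V → List (Fin k) → Set
    WellColoured P col = Colouring P col × Good col

  -- maximal monochromatic runs: the list of (colour, edges of the run)
  runs : {k : ℕ} → List ((V × V) × Fin k) → List (Fin k × List (V × V))
  runs [] = []
  runs ((e , c) ∷ rest) with runs rest
  ... | [] = (c , e ∷ []) ∷ []
  ... | (c' , es) ∷ gs with c ≟ c'
  ...   | yes _ = (c , e ∷ es) ∷ gs
  ...   | no  _ = (c , e ∷ []) ∷ (c' , es) ∷ gs

  zipL : {A B : Set} → List A → List B → List (A × B)
  zipL [] _ = []
  zipL _ [] = []
  zipL (x ∷ xs) (y ∷ ys) = (x , y) ∷ zipL xs ys

data Sign : Set where
  plus minus : Sign

module _ {n k : ℕ} (μ : Fin k → List (Fin n)) where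

  -- a run with edge sequence es traverses μ_c in μ_c's direction (plus)
  -- or against it (minus): es (resp. its reversal) is a contiguous
  -- stretch of the edge sequence of μ_c
  HasSign : Fin k → List (Fin n × Fin n) → Sign → Set
  HasSign c es plus  = Infix _≡_ es (edges {n} (μ c))
  HasSign c es minus = Infix _≡_ (reverse (map swap es)) (edges {n} (μ c))

  ColoursSignsW : List (Fin n) → List (Fin k) → List (Fin k × Sign) → Set
  ColoursSignsW P col w =
    Pointwise (λ r cs → (Data.Product.proj₁ r ≡ Data.Product.proj₁ cs)
                        × HasSign (Data.Product.proj₁ r) (Data.Product.proj₂ r) (Data.Product.proj₂ cs))
              (runs {n} (zipL {n} (edges P) col)) w

{-# OPTIONS --safe #-}
-- Call x and y aligned when one of them, say x, lies on a shortest path from a to the other.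
-- Read P and P' run by run; the current vertices stay aligned.  Two runs with the same colour
-- and sign lie on one geodesic line (μ_c or its reverse), and along each run the distance from a
-- grows by one per edge.  On that line, aligned start points have the same offset (distance from a
-- minus position on the line): if y came strictly before x, the step from y towards x would move
-- away from a, contradicting that x lies between a and y.  Advancing both runs preserves equal
-- offsets, and vertices of the line with equal offsets are aligned.  At the end b and c are
-- aligned and at the same distance d from a, so b = c.
module Submission where

open import Defs
open import Data.Nat using (ℕ; suc; _+_; _≤_; z≤n; s≤s)
open import Data.Nat.Properties
  using (≤-antisym; ≤-trans; +-assoc; +-cancelˡ-≤; +-cancelʳ-≤; +-cancelʳ-≡; m+1+n≢m; m≤m+n; n≮n)
open import Data.Nat.Tactic.RingSolver using (solve-∀)
open import Data.Fin using (Fin; _≟_)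
open import Data.List using (List; []; _∷_; _++_; [_]; length; map; reverse; concatMap)
open import Data.List.Properties
  using (∷-injective; ++-assoc; ++-cancelˡ; length-++; length-map; length-reverse;
         map-++; map-id; map-∘; reverse-++; reverse-map; reverse-involutive; unfold-reverse)
open import Data.List.Relation.Unary.All using (All; []; _∷_)
open import Data.List.Relation.Binary.Pointwise using (Pointwise; []; _∷_; Pointwise-≡⇒≡)
open import Data.List.Relation.Binary.Infix.Heterogeneous using (Infix; MkView; toView)
open import Data.Product using (Σ; ∃; ∃₂; _×_; _,_; proj₁; proj₂; swap)
open import Data.Sum using (_⊎_; inj₁; inj₂)
import Data.Sum as Sum
open import Data.Empty using (⊥-elim)
open import Relation.Nullary using (yes; no)
open import Relation.Binary.PropositionalEquality hiding ([_])

module _ {A : Set} where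

  prefix-compare : ∀ (xs ys us vs : List A) → xs ++ us ≡ ys ++ vs →
    (∃ λ zs → ys ≡ xs ++ zs) ⊎ (∃₂ λ z zs → xs ≡ ys ++ z ∷ zs)
  prefix-compare []       ys       us vs eq = inj₁ (ys , refl)
  prefix-compare (x ∷ xs) []       us vs eq = inj₂ (x , xs , refl)
  prefix-compare (x ∷ xs) (y ∷ ys) us vs eq with ∷-injective eq
  ... | refl , eq′ with prefix-compare xs ys us vs eq′
  ...   | inj₁ (zs , refl)     = inj₁ (zs , refl)
  ...   | inj₂ (z , zs , refl) = inj₂ (z , zs , refl)

  infix⇒++ : ∀ {xs ys : List A} → Infix _≡_ xs ys → ∃₂ λ pre suf → pre ++ xs ++ suf ≡ ys
  infix⇒++ inf with toView inf
  ... | MkView pre pw suf = pre , suf , cong (λ zs → pre ++ zs ++ suf) (Pointwise-≡⇒≡ pw)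

  infix-length-≤ : ∀ (p mid fs r : List A) →
    length (p ++ mid ++ r) ≤ length (p ++ fs ++ r) → length mid ≤ length fs
  infix-length-≤ []      mid fs r le =
    +-cancelʳ-≤ (length r) _ _ (subst₂ _≤_ (length-++ mid) (length-++ fs) le)
  infix-length-≤ (_ ∷ p) mid fs r (s≤s le) = infix-length-≤ p mid fs r le

  NonEmpty : List A → Set
  NonEmpty xs = ∃₂ λ y ys → xs ≡ y ∷ ys

module _ {B : Set} where

  reverseEdges : List (B × B) → List (B × B)
  reverseEdges es = reverse (map swap es)

  length-reverseEdges : ∀ es → length (reverseEdges es) ≡ length es
  length-reverseEdges es = trans (length-reverse (map swap es)) (length-map swap es)

  reverseEdges-++ : ∀ xs ys → reverseEdges (xs ++ ys) ≡ reverseEdges ys ++ reverseEdges xs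
  reverseEdges-++ xs ys = trans (cong reverse (map-++ swap xs ys)) (reverse-++ (map swap xs) (map swap ys))

  reverseEdges-involutive : ∀ es → reverseEdges (reverseEdges es) ≡ es
  reverseEdges-involutive es = begin
    reverse (map swap (reverse (map swap es))) ≡⟨ cong reverse (reverse-map swap (map swap es)) ⟩
    reverse (reverse (map swap (map swap es))) ≡⟨ reverse-involutive _ ⟩
    map swap (map swap es)                     ≡⟨ map-∘ es ⟨
    map (λ e → e) es                           ≡⟨ map-id es ⟩
    es                                         ∎
    where open ≡-Reasoning

  reverseEdges-infix : ∀ pre es suf {E} → pre ++ reverseEdges es ++ suf ≡ E →
    reverseEdges suf ++ es ++ reverseEdges pre ≡ reverseEdges E
  reverseEdges-infix pre es suf refl = sym (begin
    reverseEdges (pre ++ reverseEdges es ++ suf)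
      ≡⟨ reverseEdges-++ pre _ ⟩
    reverseEdges (reverseEdges es ++ suf) ++ reverseEdges pre
      ≡⟨ cong (_++ reverseEdges pre) (reverseEdges-++ (reverseEdges es) suf) ⟩
    (reverseEdges suf ++ reverseEdges (reverseEdges es)) ++ reverseEdges pre
      ≡⟨ ++-assoc (reverseEdges suf) _ _ ⟩
    reverseEdges suf ++ reverseEdges (reverseEdges es) ++ reverseEdges pre
      ≡⟨ cong (λ xs → reverseEdges suf ++ xs ++ reverseEdges pre) (reverseEdges-involutive es) ⟩
    reverseEdges suf ++ es ++ reverseEdges pre ∎)
    where open ≡-Reasoning

+-length-++ : ∀ {A : Set} m (q mid : List A) → m + length (q ++ mid) ≡ (m + length mid) + length q
+-length-++ m q mid = trans (cong (m +_) (length-++ q)) (shuffle m (length q) (length mid))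
  where
  shuffle : ∀ a b c → a + (b + c) ≡ (a + c) + b
  shuffle = solve-∀

offset-++ : ∀ {A : Set} {m₁ m₂} (q₁ q₂ es₁ es₂ : List A) → m₁ + length q₂ ≡ m₂ + length q₁ →
  (m₁ + length es₁) + length (q₂ ++ es₂) ≡ (m₂ + length es₂) + length (q₁ ++ es₁)
offset-++ {m₁ = m₁} {m₂} q₁ q₂ es₁ es₂ off = begin
  (m₁ + length es₁) + length (q₂ ++ es₂)       ≡⟨ cong ((m₁ + length es₁) +_) (length-++ q₂) ⟩
  (m₁ + length es₁) + (length q₂ + length es₂) ≡⟨ interchange m₁ _ _ _ ⟩
  (m₁ + length q₂) + (length es₁ + length es₂) ≡⟨ cong (_+ (length es₁ + length es₂)) off ⟩
  (m₂ + length q₁) + (length es₁ + length es₂) ≡⟨ rotate m₂ _ _ _ ⟩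
  (m₂ + length es₂) + (length q₁ + length es₁) ≡⟨ cong ((m₂ + length es₂) +_) (length-++ q₁) ⟨
  (m₂ + length es₂) + length (q₁ ++ es₁)       ∎
  where
  open ≡-Reasoning
  interchange : ∀ a b c d → (a + b) + (c + d) ≡ (a + c) + (b + d)
  interchange = solve-∀
  rotate : ∀ a b c d → (a + b) + (c + d) ≡ (a + d) + (b + c)
  rotate = solve-∀

module _ {n k : ℕ} where

  runs-concat : (Z : List ((Fin n × Fin n) × Fin k)) → concatMap proj₂ (runs Z) ≡ map proj₁ Z
  runs-concat [] = refl
  runs-concat ((e , c) ∷ rest) with runs rest | runs-concat rest
  ... | []             | ih = cong (e ∷_) ih
  ... | (c′ , es) ∷ gs | ih with c ≟ c′
  ...   | yes _ = cong (e ∷_) ih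
  ...   | no  _ = cong (e ∷_) ih

  runs-nonEmpty : (Z : List ((Fin n × Fin n) × Fin k)) → All (λ r → NonEmpty (proj₂ r)) (runs Z)
  runs-nonEmpty [] = []
  runs-nonEmpty ((e , c) ∷ rest) with runs rest | runs-nonEmpty rest
  ... | []             | _          = (e , [] , refl) ∷ []
  ... | (c′ , es) ∷ gs | ne ∷ nes with c ≟ c′
  ...   | yes _ = (e , es , refl) ∷ nes
  ...   | no  _ = (e , [] , refl) ∷ ne ∷ nes

  map-proj₁-zipL : ∀ {R : Fin n × Fin n → Fin k → Set} {es cs} →
    Pointwise R es cs → map proj₁ (zipL {n} es cs) ≡ es
  map-proj₁-zipL []       = refl
  map-proj₁-zipL (_ ∷ pw) = cong (_ ∷_) (map-proj₁-zipL pw)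

module _ {n : ℕ} (G : Graph n) where
  open Graph G

  Edge : Set
  Edge = Fin n × Fin n

  data Trace : Fin n → List Edge → Fin n → Set where
    []  : ∀ {u} → Trace u [] u
    _∷_ : ∀ {u v w es} → Adj u v → Trace v es w → Trace u ((u , v) ∷ es) w

  _++ᵗ_ : ∀ {u v w es fs} → Trace u es v → Trace v fs w → Trace u (es ++ fs) w
  []      ++ᵗ t′ = t′
  (a ∷ t) ++ᵗ t′ = a ∷ (t ++ᵗ t′)

  splitᵗ : ∀ es {u w fs} → Trace u (es ++ fs) w → ∃ λ v → Trace u es v × Trace v fs w
  splitᵗ []       t       = _ , [] , t
  splitᵗ (_ ∷ es) (a ∷ t) with splitᵗ es t
  ... | v , t₁ , t₂ = v , a ∷ t₁ , t₂

  trace-unique : ∀ {u v w es} → Trace u es v → Trace u es w → v ≡ w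
  trace-unique []      []       = refl
  trace-unique (_ ∷ t) (_ ∷ t′) = trace-unique t t′

  trace-suffix : ∀ {s u v q mid} → Trace s q u → Trace s (q ++ mid) v → Trace u mid v
  trace-suffix {q = q} tq t with splitᵗ q t
  ... | _ , tq′ , tmid with refl ← trace-unique tq tq′ = tmid

  trace-prefix : ∀ {s t u v E} q {r} → q ++ (u , v) ∷ r ≡ E → Trace s E t → Trace s q u
  trace-prefix q refl t with splitᵗ q t
  ... | _ , tq , (_ ∷ _) = tq

  reverseᵗ : ∀ {u v es} → Trace u es v → Trace v (reverseEdges es) u
  reverseᵗ []                       = []
  reverseᵗ (_∷_ {u} {v} {es = es} a t) =
    subst (λ fs → Trace _ fs u) (sym (unfold-reverse (v , u) (map swap es))) (reverseᵗ t ++ᵗ (symm a ∷ []))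

  trace⇒walk : ∀ {u v es} → Trace u es v → ∃ λ xs → Walk G u v xs × len xs ≡ length es
  trace⇒walk {u} [] = u ∷ [] , ([] , refl , refl , []) , refl
  trace⇒walk (a ∷ t) with trace⇒walk t
  ... | _ , (ys , refl , last , adj) , l = _ , (_ ∷ ys , refl , last , a ∷ adj) , cong suc l

  walk⇒trace : ∀ {u v xs} → Walk G u v xs → Trace u (edges xs) v
  walk⇒trace (ys , refl , refl , adj) = vertices⇒trace _ ys adj
    where
    vertices⇒trace : ∀ u ys → All (λ e → Adj (proj₁ e) (proj₂ e)) (edges (u ∷ ys)) →
      Trace u (edges (u ∷ ys)) (lastV u ys)
    vertices⇒trace u []       []         = []
    vertices⇒trace u (y ∷ ys) (a ∷ adj) = a ∷ vertices⇒trace y ys adj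

  walk-bound⇒trace-bound : ∀ {u v m} → (∀ ys → Walk G u v ys → m ≤ len ys) →
    ∀ {fs} → Trace u fs v → m ≤ length fs
  walk-bound⇒trace-bound bound t with trace⇒walk t
  ... | ys , w , l = subst (_ ≤_) l (bound ys w)

  Geodesic : Fin n → List Edge → Fin n → Set
  Geodesic u es v = Trace u es v × (∀ {fs} → Trace u fs v → length es ≤ length fs)

  Dist : Fin n → Fin n → ℕ → Set
  Dist u v m = (∃ λ es → Trace u es v × length es ≡ m) × (∀ {fs} → Trace u fs v → m ≤ length fs)

  shortestPath⇒geodesic : ∀ {u v xs} → ShortestPath G u v xs → Geodesic u (edges xs) v
  shortestPath⇒geodesic ((w , _) , shortest) = walk⇒trace w , walk-bound⇒trace-bound shortest

  isDist⇒dist : ∀ {u v d} → IsDist G u v d → Dist u v d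
  isDist⇒dist ((xs , w , l) , lower) = (edges xs , walk⇒trace w , l) , walk-bound⇒trace-bound lower

  geodesic⇒dist : ∀ {u v es} → Geodesic u es v → Dist u v (length es)
  geodesic⇒dist (t , shortest) = (_ , t , refl) , shortest

  dist-refl : ∀ {u} → Dist u u 0
  dist-refl = ([] , [] , refl) , λ _ → z≤n

  dist-unique : ∀ {u v m m′} → Dist u v m → Dist u v m′ → m ≡ m′
  dist-unique ((es , t , refl) , lower) ((es′ , t′ , refl) , lower′) = ≤-antisym (lower t′) (lower′ t)

  dist-triangle : ∀ {a x y m k es} → Dist a x m → Trace x es y → Dist a y k → k ≤ m + length es
  dist-triangle ((ps , tp , refl) , _) t (_ , lower) = subst (_ ≤_) (length-++ ps) (lower (tp ++ᵗ t))

  geodesic-reverse : ∀ {u v es} → Geodesic u es v → Geodesic v (reverseEdges es) u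
  geodesic-reverse {es = es} (t , shortest) =
    reverseᵗ t , λ {fs} tf →
      subst₂ _≤_ (sym (length-reverseEdges es)) (length-reverseEdges fs) (shortest (reverseᵗ tf))

  geodesic-infix : ∀ {s t x y} p {mid r} → Geodesic s (p ++ mid ++ r) t →
    Trace s p x → Trace x mid y → Geodesic x mid y
  geodesic-infix p {mid} {r} (tE , shortest) tp tmid =
    tmid , λ {fs} tf → infix-length-≤ p mid fs r (shortest (tp ++ᵗ (tf ++ᵗ tr)))
    where tr = trace-suffix tmid (trace-suffix tp tE)

  module _ (a : Fin n) where

    Rising : ℕ → Fin n → List Edge → Fin n → Set
    Rising m x es y = Dist a x m × Trace x es y × Dist a y (m + length es)

    Aligned : Fin n → Fin n → Set
    Aligned x y = ∃₂ λ m es → Rising m x es y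

    rising-++⁻ : ∀ {m x z} es {fs} → Rising m x (es ++ fs) z →
      ∃ λ y → Rising m x es y × Rising (m + length es) y fs z
    rising-++⁻ {m} {x} {z} es {fs} (dx@((ps , tp , refl) , _) , t , (_ , lower)) with splitᵗ es t
    ... | y , t₁ , t₂ = y , (dx , t₁ , dy) , (dy , t₂ , subst (Dist a z) split-length dz)
      where
      split-length : m + length (es ++ fs) ≡ (m + length es) + length fs
      split-length = trans (cong (m +_) (length-++ es)) (sym (+-assoc m _ _))
      dy : Dist a y (m + length es)
      dy = (ps ++ es , tp ++ᵗ t₁ , length-++ ps) , λ {gs} tg →
        +-cancelʳ-≤ (length fs) _ _ (subst₂ _≤_ split-length (length-++ gs) (lower (tg ++ᵗ t₂)))
      dz : Dist a z (m + length (es ++ fs))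
      dz = ((ps ++ es ++ fs) , tp ++ᵗ t , length-++ ps) , lower

    rising-successor : ∀ {m y y₁ z es} → Rising m y ((y , y₁) ∷ es) z → Dist a y₁ (m + 1)
    rising-successor r with rising-++⁻ [ _ ] r
    ... | _ , (_ , _ ∷ [] , d) , _ = d

    aligned-along : ∀ {s u v m k q mid} → Trace s q u → Trace s (q ++ mid) v →
      Dist a u m → Dist a v k → m + length (q ++ mid) ≡ k + length q → Aligned u v
    aligned-along {m = m} {q = q} {mid} tu tv du dv off =
      m , mid , du , trace-suffix tu tv ,
      subst (Dist a _) (+-cancelʳ-≡ (length q) _ _ (trans (sym off) (+-length-++ m q mid))) dv

    -- A vertex reached by the prefix q of a line at distance m from a has offset m − length q;
    -- equality of offsets is stated with both sides moved so that no subtraction occurs.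
    offsets-agree⇒aligned : ∀ {s u v m₁ m₂} q₁ q₂ {r₁ r₂} → q₁ ++ r₁ ≡ q₂ ++ r₂ →
      Trace s q₁ u → Trace s q₂ v → Dist a u m₁ → Dist a v m₂ →
      m₁ + length q₂ ≡ m₂ + length q₁ → Aligned u v ⊎ Aligned v u
    offsets-agree⇒aligned q₁ q₂ {r₁} {r₂} eq t₁ t₂ d₁ d₂ off with prefix-compare q₁ q₂ r₁ r₂ eq
    ... | inj₁ (_ , refl)     = inj₁ (aligned-along t₁ t₂ d₁ d₂ off)
    ... | inj₂ (_ , _ , refl) = inj₂ (aligned-along t₂ t₁ d₂ d₁ (sym off))

    aligned⇒offsets-agree : ∀ {s t x y y₁ m es} q₁ q₂ {r₁ r₂} →
      Geodesic s (q₂ ++ (y , y₁) ∷ r₂) t → q₁ ++ r₁ ≡ q₂ ++ (y , y₁) ∷ r₂ →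
      Trace s q₁ x → Trace s q₂ y → Rising m x es y → Dist a y₁ (m + length es + 1) →
      m + length q₂ ≡ (m + length es) + length q₁
    aligned⇒offsets-agree {m = m} {es} q₁ q₂ {r₁} geo eq t₁ t₂ (dx , txy , dy) dy₁
      with prefix-compare q₁ q₂ r₁ _ eq
    ... | inj₁ (mid , refl) =
      trans (+-length-++ m q₁ mid) (cong (λ l → (m + l) + length q₁) (sym es≡mid))
      where
      seg = trace-suffix t₁ t₂
      geo′ = subst (λ E → Geodesic _ E _) (++-assoc q₁ mid _) geo
      es≡mid : length es ≡ length mid
      es≡mid = ≤-antisym (+-cancelˡ-≤ m _ _ (dist-triangle dx seg dy))
                         (proj₂ (geodesic-infix q₁ geo′ t₁ seg) txy)
    ... | inj₂ (e , mid , refl)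
      with refl , refl ← ∷-injective (++-cancelˡ q₂ _ _ (trans (sym (++-assoc q₂ (e ∷ mid) r₁)) eq))
      with adj ∷ seg ← trace-suffix t₂ t₁ =
      -- y precedes x on the line, yet stepping from y towards x moves away from a.
      ⊥-elim (n≮n (length mid) (≤-trans mid<es (≤-trans (m≤m+n (length es) 1) es<mid)))
      where
      mid<es : 1 + length mid ≤ length es
      mid<es = subst (_ ≤_) (length-reverseEdges es)
        (proj₂ (geodesic-infix q₂ geo t₂ (adj ∷ seg)) (reverseᵗ txy))
      es<mid : length es + 1 ≤ length mid
      es<mid = +-cancelˡ-≤ m _ _ (subst₂ _≤_ (+-assoc m (length es) 1) (cong (m +_) (length-reverseEdges mid))
        (dist-triangle dx (reverseᵗ seg) dy₁))

    aligned-step : ∀ {s t E x y x′ y′ mx my eA eB esA esB} qA qB {rA rB} → Geodesic s E t →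
      qA ++ (eA ∷ esA) ++ rA ≡ E → qB ++ (eB ∷ esB) ++ rB ≡ E →
      Rising mx x (eA ∷ esA) x′ → Rising my y (eB ∷ esB) y′ →
      Aligned x y → Aligned x′ y′ ⊎ Aligned y′ x′
    aligned-step {esA = esA} {esB} qA qB {rA} {rB} geo refl eqB
                 (dx , tA@(_ ∷ _) , dx′) riseB@(dy , tB@(_ ∷ _) , dy′) (m , es , al@(dx₀ , _ , dy₀))
      with refl ← dist-unique dx₀ dx | refl ← dist-unique dy dy₀ =
      offsets-agree⇒aligned (qA ++ _ ∷ esA) (qB ++ _ ∷ esB)
        (trans (++-assoc qA _ rA) (trans (sym eqB) (sym (++-assoc qB _ rB))))
        (tqA ++ᵗ tA) (tqB ++ᵗ tB) dx′ dy′ (offset-++ qA qB (_ ∷ esA) (_ ∷ esB) offset)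
      where
      tqA = trace-prefix qA refl (proj₁ geo)
      tqB = trace-prefix qB eqB (proj₁ geo)
      offset : m + length qB ≡ (m + length es) + length qA
      offset = aligned⇒offsets-agree qA qB (subst (λ E → Geodesic _ E _) (sym eqB) geo) (sym eqB)
                 tqA tqB al (rising-successor riseB)

    module _ {k : ℕ} (μ : Fin k → List (Fin n))
             (μ-shortest : ∀ i → Σ (Fin n) λ s → Σ (Fin n) λ t → ShortestPath G s t (μ i)) where

      lineSteps : Fin k → Sign → List Edge
      lineSteps c plus  = edges (μ c)
      lineSteps c minus = reverseEdges (edges (μ c))

      line-geodesic : ∀ c sg → ∃₂ λ s t → Geodesic s (lineSteps c sg) t
      line-geodesic c plus  with μ-shortest c
      ... | s , t , sp = s , t , shortestPath⇒geodesic sp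
      line-geodesic c minus with μ-shortest c
      ... | s , t , sp = t , s , geodesic-reverse (shortestPath⇒geodesic sp)

      run-on-line : ∀ {c es} sg → HasSign μ c es sg → ∃₂ λ pre suf → pre ++ es ++ suf ≡ lineSteps c sg
      run-on-line plus  h = infix⇒++ h
      run-on-line minus h with infix⇒++ h
      ... | pre , suf , eq = reverseEdges suf , reverseEdges pre , reverseEdges-infix pre _ suf eq

      RunMatches : Fin k × List Edge → Fin k × Sign → Set
      RunMatches r cs = (proj₁ r ≡ proj₁ cs) × HasSign μ (proj₁ r) (proj₂ r) (proj₂ cs)

      lockstep : ∀ {x y b c mx my rsA rsB w} →
        Pointwise RunMatches rsA w → Pointwise RunMatches rsB w →
        All (λ r → NonEmpty (proj₂ r)) rsA → All (λ r → NonEmpty (proj₂ r)) rsB →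
        Rising mx x (concatMap proj₂ rsA) b → Rising my y (concatMap proj₂ rsB) c →
        Aligned x y ⊎ Aligned y x → Aligned b c ⊎ Aligned c b
      lockstep [] [] [] [] (_ , [] , _) (_ , [] , _) al = al
      lockstep {w = (c , sg) ∷ _} ((refl , hA) ∷ pA) ((refl , hB) ∷ pB)
               ((_ , esA , refl) ∷ neA) ((_ , esB , refl) ∷ neB) rA rB al
        with rising-++⁻ (_ ∷ esA) rA | rising-++⁻ (_ ∷ esB) rB
           | run-on-line sg hA | run-on-line sg hB | line-geodesic c sg
      ... | _ , rA₁ , rA₂ | _ , rB₁ , rB₂ | qA , _ , eqA | qB , _ , eqB | _ , _ , geo =
        lockstep pA pB neA neB rA₂ rB₂ (step al)
        where
        step : _ ⊎ _ → _ ⊎ _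
        step (inj₁ al) = aligned-step qA qB geo eqA eqB rA₁ rB₁ al
        step (inj₂ al) = Sum.swap (aligned-step qB qA geo eqB eqA rB₁ rA₁ al)

    coloured-rising : ∀ {k} {μ : Fin k → List (Fin n)} {b P col} →
      ShortestPath G a b P → Colouring μ P col →
      Rising 0 a (concatMap proj₂ (runs (zipL {n} (edges P) col))) b
    coloured-rising {P = P} {col} sp cl =
      subst (λ es → Rising 0 a es _) (sym (trans (runs-concat (zipL {n} (edges P) col)) (map-proj₁-zipL cl)))
        (dist-refl , proj₁ (shortestPath⇒geodesic sp) , geodesic⇒dist (shortestPath⇒geodesic sp))

    aligned-equidistant : ∀ {x y d} → Aligned x y → Dist a x d → Dist a y d → x ≡ y
    aligned-equidistant (m , es , dx , t , dy) dx′ dy′ with dist-unique dx dx′ | es | t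
    ... | refl | []    | [] = refl
    ... | refl | _ ∷ _ | _  = ⊥-elim (m+1+n≢m m (dist-unique dy dy′))

lemma8 : {n k : ℕ} (G : Graph n) → Connected G →
    (μ : Fin k → List (Fin n)) →
    (∀ i → Σ (Fin n) λ s → Σ (Fin n) λ t → ShortestPath G s t (μ i)) →
    (∀ u v → Graph.Adj G u v → Σ (Fin k) λ i → EdgeIn (u , v) (μ i)) →
    (a b c : Fin n) → (d : ℕ) → IsDist G a b d → IsDist G a c d →
    (P P' : List (Fin n)) (col col' : List (Fin k)) →
    ShortestPath G a b P → WellColoured μ P col →
    ShortestPath G a c P' → WellColoured μ P' col' →
    (w : List (Fin k × Sign)) →
    ColoursSignsW μ P col w → ColoursSignsW μ P' col' w →
    b ≡ c
lemma8 {n} G _ μ μ-shortest _ a b c d db dc P P' col col' sp (cl , _) sp' (cl' , _) w csw csw' =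
  Sum.[ (λ al → aligned-equidistant G a al db′ dc′)
      , (λ al → sym (aligned-equidistant G a al dc′ db′)) ] endpoints-aligned
  where
  db′ = isDist⇒dist G db
  dc′ = isDist⇒dist G dc
  endpoints-aligned : Aligned G a b c ⊎ Aligned G a c b
  endpoints-aligned = lockstep G a μ μ-shortest csw csw'
    (runs-nonEmpty (zipL {n} (edges P) col)) (runs-nonEmpty (zipL {n} (edges P') col'))
    (coloured-rising G a sp cl) (coloured-rising G a sp' cl')
    (inj₁ (0 , [] , dist-refl G , [] , dist-refl G))
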